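{- Let $Z\in\{T,B,L,A\}$. For $n\ge1$ let $\mathcal{F}_n^2$ be the set of forests of $n$ binary shrubs with label set $\{1,\ldots,3n\}$, and let $\mathrm{IZF}_n^2$ be the number of $F=(F_1,\ldots,F_n)\in\mathcal{F}_n^2$ with $F_1<_Z F_2<_Z\cdots<_Z F_n$. For $F\in\mathcal{F}_n^2$ let $\mathrm{risZ}(F)=|\{i\in\{1,\ldots,n-1\}:F_i<_Z F_{i+1}\}|$. Then $$\mathcal{RZ}(x,t):=1+\sum_{n\ge1}\frac{t^{3n}}{(3n)!}\sum_{F\in\mathcal{F}_n^2}x^{\mathrm{risZ}(F)}=\frac{1}{1-\sum_{n\ge1}\frac{t^{3n}}{(3n)!}(x-1)^{n-1}\mathrm{IZF}_n^2}.$$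
   Context: A binary shrub is a tree consisting of a root with an ordered pair of children (left and right), labeled by distinct positive integers so that the root's label is smaller than both children's labels; its word is (root, left child, right child). A forest of $n$ binary shrubs with label set $\{1,\ldots,3n\}$ is an ordered sequence $F=(F_1,\ldots,F_n)$ of binary shrubs whose labels together are exactly $\{1,\ldots,3n\}$, each used once. For two shrubs with words $abc$ and $def$: $abc<_T def$ if every element of $\{a,b,c\}$ is less than every element of $\{d,e,f\}$; $abc<_B def$ if $a<d$; $abc<_L def$ if $a<d$, $b<e$ and $c<f$; $abc<_A def$ if $c<e$. -}

module Defs where

open import Data.Nat as ℕ using (ℕ; zero; suc; _<ᵇ_; _!; _*_)
open import Data.Nat.Properties using (_!≢0)
open import Data.Bool using (Bool; true; false; _∧_; if_then_else_)
open import Data.Product using (_×_; _,_)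
open import Data.List using (List; []; _∷_; map; concatMap; upTo; length; foldr)
open import Data.Integer using (+_)
open import Data.Rational using (ℚ; 0ℚ; 1ℚ; _+_; _-_; _/_)
import Data.Rational as Q

-- A binary shrub, given by its word (root, left child, right child).
Shrub : Set
Shrub = ℕ × ℕ × ℕ

isShrub : Shrub → Bool
isShrub (a , b , c) = (a <ᵇ b) ∧ (a <ᵇ c)

data Z : Set where
  T B L A : Z

_<[_]_ : Shrub → Z → Shrub → Bool
(a , b , c) <[ T ] (d , e , f) =
  ((a <ᵇ d) ∧ (a <ᵇ e) ∧ (a <ᵇ f)) ∧
  ((b <ᵇ d) ∧ (b <ᵇ e) ∧ (b <ᵇ f)) ∧
  ((c <ᵇ d) ∧ (c <ᵇ e) ∧ (c <ᵇ f))
(a , b , c) <[ B ] (d , e , f) = a <ᵇ d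
(a , b , c) <[ L ] (d , e , f) = (a <ᵇ d) ∧ (b <ᵇ e) ∧ (c <ᵇ f)
(a , b , c) <[ A ] (d , e , f) = c <ᵇ e

insertAll : {X : Set} → X → List X → List (List X)
insertAll x [] = (x ∷ []) ∷ []
insertAll x (y ∷ ys) = (x ∷ y ∷ ys) ∷ map (y ∷_) (insertAll x ys)

perms : {X : Set} → List X → List (List X)
perms [] = [] ∷ []
perms (x ∷ xs) = concatMap (insertAll x) (perms xs)

chunk3 : List ℕ → List Shrub
chunk3 (a ∷ b ∷ c ∷ rest) = (a , b , c) ∷ chunk3 rest
chunk3 _ = []

allShrubs : List Shrub → Bool
allShrubs [] = true
allShrubs (s ∷ ss) = isShrub s ∧ allShrubs ss

filterB : {X : Set} → (X → Bool) → List X → List X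
filterB p [] = []
filterB p (x ∷ xs) = if p x then x ∷ filterB p xs else filterB p xs

labels : ℕ → List ℕ
labels m = map suc (upTo m)

-- 𝓕ₙ² : the list of all forests (F₁,…,Fₙ) of n binary shrubs with label
-- set {1,…,3n}; a forest is the sequence of its shrub words, i.e. an
-- ordering of {1,…,3n} cut into triples each satisfying the shrub condition.
forests : ℕ → List (List Shrub)
forests n = filterB allShrubs (map chunk3 (perms (labels (3 * n))))

ris : Z → List Shrub → ℕ
ris z (s ∷ t ∷ rest) = (if s <[ z ] t then 1 else 0) ℕ.+ ris z (t ∷ rest)
ris z _ = 0

increasing : Z → List Shrub → Bool
increasing z (s ∷ t ∷ rest) = (s <[ z ] t) ∧ increasing z (t ∷ rest)
increasing z _ = true

IZF : Z → ℕ → ℕ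
IZF z n = length (filterB (increasing z) (forests n))

pow : ℚ → ℕ → ℚ
pow x zero = 1ℚ
pow x (suc k) = x Q.* pow x k

sumℚ : List ℚ → ℚ
sumℚ = foldr _+_ 0ℚ

fromℕ : ℕ → ℚ
fromℕ k = (+ k) / 1

FPS : Set
FPS = ℕ → ℚ

oneS : FPS
oneS zero = 1ℚ
oneS (suc _) = 0ℚ

_-S_ : FPS → FPS → FPS
(f -S g) m = f m - g m

_*S_ : FPS → FPS → FPS
(f *S g) m = sumℚ (map (λ i → f i Q.* g (m ℕ.∸ i)) (upTo (suc m)))

-- Σ_{n≥1} c(n) t^{3n}/(3n)!  (coefficient of t^m)
egf3 : (ℕ → ℚ) → FPS
egf3 c zero = 0ℚ
egf3 c (suc m) = go (suc m) (suc m ℕ.% 3)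
  where
    go : ℕ → ℕ → ℚ
    go k zero = (c (k ℕ./ 3) Q.* ((+ 1) / (k !)) {{k !≢0}})
    go k (suc _) = 0ℚ

RZ : Z → ℚ → FPS
RZ z x m = oneS m + egf3 (λ n → sumℚ (map (λ F → pow x (ris z F)) (forests n))) m

IZseries : Z → ℚ → FPS
IZseries z x = egf3 (λ n → pow (x - 1ℚ) (n ℕ.∸ 1) Q.* fromℕ (IZF z n))

-- Writing x = 1 + (x − 1) at every ascent of a forest F = (F₁, …, Fₙ) gives
--   x^risZ(F) = Σₖ [F₁ <_Z ⋯ <_Z F_{k+1}] (x − 1)^k x^risZ(F_{k+2}, …, Fₙ).
-- Sum over all forests, choosing which 3(k + 1) of the 3n labels form the first k + 1 shrubs.
-- Shrub conditions, ascents and <_Z only compare labels, so relabelling each part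
-- order-preservingly by {1, …, 3m} yields
--   Σ_{F ∈ 𝓕ₙ²} x^risZ(F) = Σₖ C(3n, 3(k+1)) (x − 1)^k IZF²_{k+1} Σ_{F ∈ 𝓕²_{n−k−1}} x^risZ(F),
-- which says that 𝓡Z − 1 = 𝓡Z · Σₙ t^{3n}/(3n)! (x − 1)^{n−1} IZFₙ².

module Submission where

open import Defs
open import Data.Rational using (ℚ)
open import Data.Nat using (ℕ)
open import Relation.Binary.PropositionalEquality using (_≡_)

open import Data.Bool using (Bool; true; false; _∧_; if_then_else_)
open import Data.Bool.Properties using (∧-assoc)
import Data.Integer as ℤ
open import Data.List using (List; []; _∷_; map; concatMap; upTo; applyUpTo; length; take; drop; _++_)
import Data.List.Properties as List
open import Data.List.Relation.Unary.All as All using (All; []; _∷_)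
open import Data.List.Relation.Unary.All.Properties using (++⁺; map⁺; concat⁺)
open import Data.Maybe using (nothing)
open import Data.Nat as ℕ using (zero; suc; _!; _<ᵇ_; _≤_; _<_; z≤n; s≤s; _∸_)
open import Data.Nat.Combinatorics using (_C_; nCk+nC[k+1]≡[n+1]C[k+1]; nCk≡n!/k![n-k]!; k![n∸k]!∣n!)
import Data.Nat.DivMod as ℕ
import Data.Nat.Properties as ℕ
open import Data.Product using (_×_; _,_; proj₁; proj₂; map₁; map₂)
open import Data.Rational as ℚ using (0ℚ; 1ℚ; -_; _+_; _*_; _-_)
import Data.Rational.Properties as ℚ
import Data.Rational.Unnormalised as ℚᵘ
import Data.Rational.Unnormalised.Properties as ℚᵘ
open import Data.Sum using (inj₁; inj₂)
open import Data.Unit using (⊤; tt)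
open import Function using (_∘_)
open import Relation.Binary.Definitions using (tri<; tri≈; tri>)
open import Relation.Nullary using (yes; no)
open import Relation.Binary.PropositionalEquality using (refl; sym; trans; cong; cong₂; subst; module ≡-Reasoning)
open import Tactic.RingSolver using (solve-∀)
open import Tactic.RingSolver.Core.AlmostCommutativeRing using (AlmostCommutativeRing; fromCommutativeRing)
import Data.Integer.Tactic.RingSolver as ℤ

ℚ-ring : AlmostCommutativeRing _ _
ℚ-ring = fromCommutativeRing ℚ.+-*-commutativeRing (λ _ → nothing)

-- Finite sums

private
  variable
    X Y : Set

∑ : (X → ℚ) → List X → ℚ
∑ f xs = sumℚ (map f xs)

∑-++ : (f : X → ℚ) (xs ys : List X) → ∑ f (xs ++ ys) ≡ ∑ f xs + ∑ f ys
∑-++ f [] ys = sym (ℚ.+-identityˡ _)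
∑-++ f (x ∷ xs) ys = trans (cong (f x +_) (∑-++ f xs ys)) (sym (ℚ.+-assoc (f x) _ _))

∑-map : (f : Y → ℚ) (g : X → Y) (xs : List X) → ∑ f (map g xs) ≡ ∑ (f ∘ g) xs
∑-map f g [] = refl
∑-map f g (x ∷ xs) = cong (f (g x) +_) (∑-map f g xs)

∑-concatMap : (f : Y → ℚ) (g : X → List Y) (xs : List X) →
  ∑ f (concatMap g xs) ≡ ∑ (λ x → ∑ f (g x)) xs
∑-concatMap f g [] = refl
∑-concatMap f g (x ∷ xs) =
  trans (∑-++ f (g x) (concatMap g xs)) (cong (∑ f (g x) +_) (∑-concatMap f g xs))

∑-cong : {f g : X → ℚ} → (∀ x → f x ≡ g x) → (xs : List X) → ∑ f xs ≡ ∑ g xs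
∑-cong f≡g [] = refl
∑-cong f≡g (x ∷ xs) = cong₂ _+_ (f≡g x) (∑-cong f≡g xs)

∑-congᴬ : {f g : X → ℚ} {xs : List X} → All (λ x → f x ≡ g x) xs → ∑ f xs ≡ ∑ g xs
∑-congᴬ [] = refl
∑-congᴬ (e ∷ es) = cong₂ _+_ e (∑-congᴬ es)

∑-0 : (xs : List X) → ∑ (λ _ → 0ℚ) xs ≡ 0ℚ
∑-0 [] = refl
∑-0 (x ∷ xs) = trans (ℚ.+-identityˡ _) (∑-0 xs)

∑-+ : (f g : X → ℚ) (xs : List X) → ∑ (λ x → f x + g x) xs ≡ ∑ f xs + ∑ g xs
∑-+ f g [] = refl
∑-+ f g (x ∷ xs) = trans (cong (f x + g x +_) (∑-+ f g xs)) (interchange (f x) (g x) _ _)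
  where
  interchange : ∀ a b c d → (a + b) + (c + d) ≡ (a + c) + (b + d)
  interchange = solve-∀ ℚ-ring

∑-*ˡ : (c : ℚ) (f : X → ℚ) (xs : List X) → ∑ (λ x → c * f x) xs ≡ c * ∑ f xs
∑-*ˡ c f [] = sym (ℚ.*-zeroʳ c)
∑-*ˡ c f (x ∷ xs) = trans (cong (c * f x +_) (∑-*ˡ c f xs)) (sym (ℚ.*-distribˡ-+ c (f x) _))

∑-*ʳ : (c : ℚ) (f : X → ℚ) (xs : List X) → ∑ (λ x → f x * c) xs ≡ ∑ f xs * c
∑-*ʳ c f xs = trans (∑-cong (λ x → ℚ.*-comm (f x) c) xs) (trans (∑-*ˡ c f xs) (ℚ.*-comm c _))

∑-comm : (f : X → Y → ℚ) (xs : List X) (ys : List Y) →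
  ∑ (λ x → ∑ (f x) ys) xs ≡ ∑ (λ y → ∑ (λ x → f x y) xs) ys
∑-comm f [] ys = sym (∑-0 ys)
∑-comm f (x ∷ xs) ys = trans (cong (∑ (f x) ys +_) (∑-comm f xs ys))
  (sym (∑-+ (f x) (λ y → ∑ (λ x' → f x' y) xs) ys))

∑-neg : (f : X → ℚ) (xs : List X) → ∑ (λ x → - f x) xs ≡ - ∑ f xs
∑-neg f [] = refl
∑-neg f (x ∷ xs) = trans (cong (- f x +_) (∑-neg f xs)) (sym (ℚ.neg-distrib-+ (f x) _))

∑-*-∑ : (f : X → ℚ) (g : Y → ℚ) (xs : List X) (ys : List Y) →
  ∑ (λ x → ∑ (λ y → f x * g y) ys) xs ≡ ∑ f xs * ∑ g ys
∑-*-∑ f g xs ys = trans (∑-cong (λ x → ∑-*ˡ (f x) g ys) xs) (∑-*ʳ (∑ g ys) f xs)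

𝟙 : Bool → ℚ
𝟙 b = if b then 1ℚ else 0ℚ

𝟙-∧ : ∀ a b → 𝟙 (a ∧ b) ≡ 𝟙 a * 𝟙 b
𝟙-∧ true b = sym (ℚ.*-identityˡ (𝟙 b))
𝟙-∧ false b = sym (ℚ.*-zeroˡ (𝟙 b))

∑-filterB : (f : X → ℚ) (p : X → Bool) (xs : List X) →
  ∑ f (filterB p xs) ≡ ∑ (λ x → 𝟙 (p x) * f x) xs
∑-filterB f p [] = refl
∑-filterB f p (x ∷ xs) with p x
... | true = cong₂ _+_ (sym (ℚ.*-identityˡ (f x))) (∑-filterB f p xs)
... | false = trans (∑-filterB f p xs) (sym (trans (cong (_+ _) (ℚ.*-zeroˡ (f x))) (ℚ.+-identityˡ _)))

fromℕ-suc : ∀ k → fromℕ (suc k) ≡ 1ℚ + fromℕ k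
fromℕ-suc k = ℚ.toℚᵘ-injective
  (ℚᵘ.≃-trans (ℚ.toℚᵘ-fromℚᵘ (ℚᵘ.mkℚᵘ (ℤ.+ suc k) 0))
  (ℚᵘ.≃-trans (ℚᵘ.*≡* (1+k≃ (ℤ.+ k)))
  (ℚᵘ.≃-sym (ℚᵘ.≃-trans (ℚ.toℚᵘ-homo-+ 1ℚ (fromℕ k))
                        (ℚᵘ.+-congʳ ℚᵘ.1ℚᵘ (ℚ.toℚᵘ-fromℚᵘ (ℚᵘ.mkℚᵘ (ℤ.+ k) 0)))))))
  where
  1+k≃ : ∀ (k : ℤ.ℤ) →
    (ℤ.+ 1 ℤ.+ k) ℤ.* (ℤ.+ 1 ℤ.* ℤ.+ 1) ≡ (ℤ.+ 1 ℤ.* ℤ.+ 1 ℤ.+ k ℤ.* ℤ.+ 1) ℤ.* ℤ.+ 1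
  1+k≃ = ℤ.solve-∀

fromℕ-+ : ∀ a b → fromℕ (a ℕ.+ b) ≡ fromℕ a + fromℕ b
fromℕ-+ zero b = sym (ℚ.+-identityˡ (fromℕ b))
fromℕ-+ (suc a) b = begin
  fromℕ (suc a ℕ.+ b)          ≡⟨ fromℕ-suc (a ℕ.+ b) ⟩
  1ℚ + fromℕ (a ℕ.+ b)          ≡⟨ cong (1ℚ +_) (fromℕ-+ a b) ⟩
  1ℚ + (fromℕ a + fromℕ b)      ≡⟨ ℚ.+-assoc 1ℚ (fromℕ a) (fromℕ b) ⟨
  (1ℚ + fromℕ a) + fromℕ b      ≡⟨ cong (_+ fromℕ b) (fromℕ-suc a) ⟨
  fromℕ (suc a) + fromℕ b       ∎
  where open ≡-Reasoning

fromℕ-* : ∀ a b → fromℕ (a ℕ.* b) ≡ fromℕ a * fromℕ b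
fromℕ-* zero b = sym (ℚ.*-zeroˡ (fromℕ b))
fromℕ-* (suc a) b = begin
  fromℕ (b ℕ.+ a ℕ.* b)               ≡⟨ fromℕ-+ b (a ℕ.* b) ⟩
  fromℕ b + fromℕ (a ℕ.* b)           ≡⟨ cong₂ _+_ (sym (ℚ.*-identityˡ (fromℕ b))) (fromℕ-* a b) ⟩
  1ℚ * fromℕ b + fromℕ a * fromℕ b    ≡⟨ ℚ.*-distribʳ-+ (fromℕ b) 1ℚ (fromℕ a) ⟨
  (1ℚ + fromℕ a) * fromℕ b            ≡⟨ cong (_* fromℕ b) (fromℕ-suc a) ⟨
  fromℕ (suc a) * fromℕ b             ∎
  where open ≡-Reasoning

fromℕ-length : (xs : List X) → fromℕ (length xs) ≡ ∑ (λ _ → 1ℚ) xs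
fromℕ-length [] = refl
fromℕ-length (x ∷ xs) = trans (fromℕ-suc (length xs)) (cong (1ℚ +_) (fromℕ-length xs))

∑-const : (c : ℚ) (xs : List X) → ∑ (λ _ → c) xs ≡ fromℕ (length xs) * c
∑-const c xs = begin
  ∑ (λ _ → c) xs         ≡⟨ ∑-cong (λ _ → ℚ.*-identityˡ c) xs ⟨
  ∑ (λ _ → 1ℚ * c) xs    ≡⟨ ∑-*ʳ c (λ _ → 1ℚ) xs ⟩
  ∑ (λ _ → 1ℚ) xs * c    ≡⟨ cong (_* c) (fromℕ-length xs) ⟨
  fromℕ (length xs) * c  ∎
  where open ≡-Reasoning

fromℕ-length-filterB : (p : X → Bool) (xs : List X) →
  fromℕ (length (filterB p xs)) ≡ ∑ (𝟙 ∘ p) xs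
fromℕ-length-filterB p xs =
  trans (fromℕ-length (filterB p xs))
  (trans (∑-filterB (λ _ → 1ℚ) p xs) (∑-cong (λ x → ℚ.*-identityʳ (𝟙 (p x))) xs))

1/ℕ : (k : ℕ) → .{{ℕ.NonZero k}} → ℚ
1/ℕ k = (ℤ.+ 1) ℚ./ k

1/ℕ-inverseˡ : ∀ k .{{_ : ℕ.NonZero k}} → 1/ℕ k * fromℕ k ≡ 1ℚ
1/ℕ-inverseˡ (suc k) = ℚ.toℚᵘ-injective
  (ℚᵘ.≃-trans (ℚ.toℚᵘ-homo-* (1/ℕ (suc k)) (fromℕ (suc k)))
  (ℚᵘ.≃-trans (ℚᵘ.*-cong (ℚ.toℚᵘ-fromℚᵘ (ℚᵘ.mkℚᵘ (ℤ.+ 1) k))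
                          (ℚ.toℚᵘ-fromℚᵘ (ℚᵘ.mkℚᵘ (ℤ.+ suc k) 0)))
              (ℚᵘ.*-inverseˡ (ℚᵘ.mkℚᵘ (ℤ.+ suc k) 0))))

1/! : ℕ → ℚ
1/! k = 1/ℕ (k !) {{k ℕ.!≢0}}

∑< : ℕ → (ℕ → ℚ) → ℚ
∑< n f = sumℚ (applyUpTo f n)

∑-upTo : (f : ℕ → ℚ) (n : ℕ) → ∑ f (upTo n) ≡ ∑< n f
∑-upTo f n = cong sumℚ (List.map-upTo f n)

∑<-sucʳ : ∀ n f → ∑< (suc n) f ≡ ∑< n f + f n
∑<-sucʳ zero f = trans (ℚ.+-identityʳ (f 0)) (sym (ℚ.+-identityˡ (f 0)))
∑<-sucʳ (suc n) f = trans (cong (f 0 +_) (∑<-sucʳ n (f ∘ suc))) (sym (ℚ.+-assoc (f 0) _ _))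

∑<-cong : ∀ n {f g : ℕ → ℚ} → (∀ i → i < n → f i ≡ g i) → ∑< n f ≡ ∑< n g
∑<-cong zero f≡g = refl
∑<-cong (suc n) f≡g = cong₂ _+_ (f≡g 0 (s≤s z≤n)) (∑<-cong n (λ i i<n → f≡g (suc i) (s≤s i<n)))

∑<-0 : ∀ n → ∑< n (λ _ → 0ℚ) ≡ 0ℚ
∑<-0 n = trans (sym (∑-upTo _ n)) (∑-0 (upTo n))

∑<-*ˡ : ∀ n c (f : ℕ → ℚ) → ∑< n (λ i → c * f i) ≡ c * ∑< n f
∑<-*ˡ n c f = trans (sym (∑-upTo _ n)) (trans (∑-*ˡ c f (upTo n)) (cong (c *_) (∑-upTo f n)))

∑<-*ʳ : ∀ n c (f : ℕ → ℚ) → ∑< n (λ i → f i * c) ≡ ∑< n f * c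
∑<-*ʳ n c f = trans (sym (∑-upTo _ n)) (trans (∑-*ʳ c f (upTo n)) (cong (_* c) (∑-upTo f n)))

∑-∑<-comm : (m : ℕ) (g : ℕ → X → ℚ) (xs : List X) →
  ∑ (λ p → ∑< m (λ k → g k p)) xs ≡ ∑< m (λ k → ∑ (g k) xs)
∑-∑<-comm m g xs =
  trans (∑-cong (λ p → sym (∑-upTo (λ k → g k p) m)) xs)
  (trans (∑-comm (λ p k → g k p) xs (upTo m)) (∑-upTo (λ k → ∑ (g k) xs) m))

∑<-reverse : ∀ n f → ∑< n f ≡ ∑< n (λ i → f (n ∸ suc i))
∑<-reverse zero f = refl
∑<-reverse (suc n) f = begin
  f 0 + ∑< n (f ∘ suc)
    ≡⟨ cong (f 0 +_) (∑<-reverse n (f ∘ suc)) ⟩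
  f 0 + ∑< n (λ i → f (suc (n ∸ suc i)))
    ≡⟨ cong (f 0 +_) (∑<-cong n (λ i i<n → cong f (ℕ.+-∸-assoc 1 i<n))) ⟨
  f 0 + ∑< n (λ i → f (n ∸ i))
    ≡⟨ ℚ.+-comm (f 0) _ ⟩
  ∑< n (λ i → f (n ∸ i)) + f 0
    ≡⟨ cong (λ k → ∑< n (λ i → f (n ∸ i)) + f k) (ℕ.n∸n≡0 n) ⟨
  ∑< n (λ i → f (n ∸ i)) + f (n ∸ n)
    ≡⟨ ∑<-sucʳ n (λ i → f (suc n ∸ suc i)) ⟨
  ∑< (suc n) (λ i → f (suc n ∸ suc i))
    ∎
  where open ≡-Reasoning

-- Permutations and their cuts

length-insertAll : (y : X) (p : List X) → All (λ q → length q ≡ suc (length p)) (insertAll y p)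
length-insertAll y [] = refl ∷ []
length-insertAll y (x ∷ p) = refl ∷ map⁺ (All.map (cong suc) (length-insertAll y p))

length-perms : (xs : List X) → All (λ p → length p ≡ length xs) (perms xs)
length-perms [] = refl ∷ []
length-perms (y ∷ xs) = concat⁺ (map⁺ (All.map
  (λ {p} |p|≡ → All.map (λ |q|≡ → trans |q|≡ (cong suc |p|≡)) (length-insertAll y p))
  (length-perms xs)))

∑-perms-∷ : (f : List X → ℚ) (y : X) (xs : List X) →
  ∑ f (perms (y ∷ xs)) ≡ ∑ (λ p → ∑ f (insertAll y p)) (perms xs)
∑-perms-∷ f y xs = ∑-concatMap f (insertAll y) (perms xs)

atCut : ℕ → (List X → List X → ℚ) → List X → ℚ
atCut j h p = h (take j p) (drop j p)

insertˡ insertʳ : X → (List X → List X → ℚ) → List X → List X → ℚ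
insertˡ y h a b = ∑ (λ a′ → h a′ b) (insertAll y a)
insertʳ y h a b = ∑ (h a) (insertAll y b)

∑-insertAll-atCut : (y : X) (h : List X → List X → ℚ) (j : ℕ) (p : List X) → suc j ≤ length p →
  ∑ (atCut (suc j) h) (insertAll y p) ≡ atCut j (insertˡ y h) p + atCut (suc j) (insertʳ y h) p
∑-insertAll-atCut y h zero (x ∷ p) _ =
  cong₂ _+_ (sym (ℚ.+-identityʳ (h (y ∷ []) (x ∷ p)))) (∑-map (atCut 1 h) (x ∷_) (insertAll y p))
∑-insertAll-atCut y h (suc j) (x ∷ p) (s≤s j<|p|) = begin
  h₀ + ∑ (atCut (2 ℕ.+ j) h) (map (x ∷_) (insertAll y p))
    ≡⟨ cong (h₀ +_) (∑-map _ (x ∷_) (insertAll y p)) ⟩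
  h₀ + ∑ (atCut (suc j) hₓ) (insertAll y p)
    ≡⟨ cong (h₀ +_) (∑-insertAll-atCut y hₓ j p j<|p|) ⟩
  h₀ + (atCut j (insertˡ y hₓ) p + atCut (suc j) (insertʳ y hₓ) p)
    ≡⟨ ℚ.+-assoc h₀ _ _ ⟨
  (h₀ + atCut j (insertˡ y hₓ) p) + atCut (suc j) (insertʳ y hₓ) p
    ≡⟨ cong (λ s → (h₀ + s) + atCut (suc j) (insertʳ y hₓ) p)
            (∑-map (λ a → h a (drop j p)) (x ∷_) (insertAll y (take j p))) ⟨
  atCut (suc j) (insertˡ y h) (x ∷ p) + atCut (2 ℕ.+ j) (insertʳ y h) (x ∷ p)
    ∎
  where
  open ≡-Reasoning
  h₀ = h (y ∷ x ∷ take j p) (drop j p)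
  hₓ = λ a → h (x ∷ a)

∑-insertAll-atCut-short : (y : X) (h : List X → List X → ℚ) (j : ℕ) (p : List X) → length p ≤ j →
  ∑ (atCut (suc j) h) (insertAll y p) ≡ atCut j (insertˡ y h) p
∑-insertAll-atCut-short y h j p |p|≤j =
  trans (∑-congᴬ (All.map uncut (length-insertAll y p)))
        (cong₂ (insertˡ y h) (sym (List.take-all j p |p|≤j)) (sym (List.drop-all j p |p|≤j)))
  where
  uncut : ∀ {q} → length q ≡ suc (length p) → atCut (suc j) h q ≡ h q []
  uncut {q} |q|≡ = cong₂ h (List.take-all (suc j) q |q|≤) (List.drop-all (suc j) q |q|≤)
    where |q|≤ = subst (_≤ suc j) (sym |q|≡) (s≤s |p|≤j)

splits : ℕ → List X → List (List X × List X)
splits zero xs = ([] , xs) ∷ []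
splits (suc j) [] = []
splits (suc j) (y ∷ ys) = map (map₁ (y ∷_)) (splits j ys) ++ map (map₂ (y ∷_)) (splits (suc j) ys)

splits≡[] : ∀ j (xs : List X) → length xs < j → splits j xs ≡ []
splits≡[] (suc j) [] _ = refl
splits≡[] (suc j) (y ∷ ys) (s≤s |ys|<j)
  rewrite splits≡[] j ys |ys|<j | splits≡[] (suc j) ys (ℕ.m<n⇒m<1+n |ys|<j) = refl

length-splits : ∀ j (xs : List X) → length (splits j xs) ≡ length xs C j
length-splits zero xs = refl
length-splits (suc j) [] = refl
length-splits (suc j) (y ∷ ys) = begin
  length (map (map₁ (y ∷_)) (splits j ys) ++ map (map₂ (y ∷_)) (splits (suc j) ys))
    ≡⟨ List.length-++ (map (map₁ (y ∷_)) (splits j ys)) ⟩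
  length (map (map₁ (y ∷_)) (splits j ys)) ℕ.+ length (map (map₂ (y ∷_)) (splits (suc j) ys))
    ≡⟨ cong₂ ℕ._+_ (List.length-map _ (splits j ys)) (List.length-map _ (splits (suc j) ys)) ⟩
  length (splits j ys) ℕ.+ length (splits (suc j) ys)
    ≡⟨ cong₂ ℕ._+_ (length-splits j ys) (length-splits (suc j) ys) ⟩
  length ys C j ℕ.+ length ys C suc j
    ≡⟨ nCk+nC[k+1]≡[n+1]C[k+1] (length ys) j ⟩
  suc (length ys) C suc j
    ∎
  where open ≡-Reasoning

∑∑perms : (List X → List X → ℚ) → List X × List X → ℚ
∑∑perms h (a , b) = ∑ (λ p → ∑ (h p) (perms b)) (perms a)

∑∑perms-splits-∷ : (y : X) (h : List X → List X → ℚ) (j : ℕ) (ys : List X) →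
  ∑ (∑∑perms h) (splits (suc j) (y ∷ ys)) ≡
  ∑ (∑∑perms (insertˡ y h)) (splits j ys) + ∑ (∑∑perms (insertʳ y h)) (splits (suc j) ys)
∑∑perms-splits-∷ y h j ys =
  trans (∑-++ (∑∑perms h) (map (map₁ (y ∷_)) (splits j ys)) _)
  (cong₂ _+_ (trans (∑-map (∑∑perms h) (map₁ (y ∷_)) (splits j ys)) (∑-cong y-left (splits j ys)))
             (trans (∑-map (∑∑perms h) (map₂ (y ∷_)) (splits (suc j) ys)) (∑-cong y-right (splits (suc j) ys))))
  where
  y-left : ∀ ab → ∑∑perms h (map₁ (y ∷_) ab) ≡ ∑∑perms (insertˡ y h) ab
  y-left (a , b) = trans (∑-perms-∷ (λ p → ∑ (h p) (perms b)) y a)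
    (∑-cong (λ a₀ → ∑-comm h (insertAll y a₀) (perms b)) (perms a))
  y-right : ∀ ab → ∑∑perms h (map₂ (y ∷_) ab) ≡ ∑∑perms (insertʳ y h) ab
  y-right (a , b) = ∑-cong (λ p → ∑-perms-∷ (h p) y b) (perms a)

∑-perms-atCut : ∀ j (xs : List X) (h : List X → List X → ℚ) → j ≤ length xs →
  ∑ (atCut j h) (perms xs) ≡ ∑ (∑∑perms h) (splits j xs)
∑-perms-atCut zero xs h _ = sym (trans (ℚ.+-identityʳ _) (ℚ.+-identityʳ _))
∑-perms-atCut (suc j) (y ∷ ys) h (s≤s j≤|ys|) with suc j ℕ.≤? length ys
... | yes j<|ys| = begin
  ∑ (atCut (suc j) h) (perms (y ∷ ys))
    ≡⟨ ∑-perms-∷ (atCut (suc j) h) y ys ⟩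
  ∑ (λ p → ∑ (atCut (suc j) h) (insertAll y p)) (perms ys)
    ≡⟨ ∑-congᴬ (All.map (λ |p|≡ → ∑-insertAll-atCut y h j _ (subst (suc j ≤_) (sym |p|≡) j<|ys|))
                        (length-perms ys)) ⟩
  ∑ (λ p → atCut j (insertˡ y h) p + atCut (suc j) (insertʳ y h) p) (perms ys)
    ≡⟨ ∑-+ (atCut j (insertˡ y h)) (atCut (suc j) (insertʳ y h)) (perms ys) ⟩
  ∑ (atCut j (insertˡ y h)) (perms ys) + ∑ (atCut (suc j) (insertʳ y h)) (perms ys)
    ≡⟨ cong₂ _+_ (∑-perms-atCut j ys (insertˡ y h) j≤|ys|) (∑-perms-atCut (suc j) ys (insertʳ y h) j<|ys|) ⟩
  ∑ (∑∑perms (insertˡ y h)) (splits j ys) + ∑ (∑∑perms (insertʳ y h)) (splits (suc j) ys)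
    ≡⟨ ∑∑perms-splits-∷ y h j ys ⟨
  ∑ (∑∑perms h) (splits (suc j) (y ∷ ys))
    ∎
  where open ≡-Reasoning
... | no j≮|ys| = begin
  ∑ (atCut (suc j) h) (perms (y ∷ ys))
    ≡⟨ ∑-perms-∷ (atCut (suc j) h) y ys ⟩
  ∑ (λ p → ∑ (atCut (suc j) h) (insertAll y p)) (perms ys)
    ≡⟨ ∑-congᴬ (All.map (λ |p|≡ → ∑-insertAll-atCut-short y h j _ (subst (_≤ j) (sym |p|≡) |ys|≤j))
                        (length-perms ys)) ⟩
  ∑ (atCut j (insertˡ y h)) (perms ys)
    ≡⟨ ∑-perms-atCut j ys (insertˡ y h) j≤|ys| ⟩
  ∑ (∑∑perms (insertˡ y h)) (splits j ys)
    ≡⟨ ℚ.+-identityʳ _ ⟨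
  ∑ (∑∑perms (insertˡ y h)) (splits j ys) + 0ℚ
    ≡⟨ cong (λ s → ∑ (∑∑perms (insertˡ y h)) (splits j ys) + ∑ (∑∑perms (insertʳ y h)) s)
            (splits≡[] (suc j) ys (ℕ.≰⇒> j≮|ys|)) ⟨
  ∑ (∑∑perms (insertˡ y h)) (splits j ys) + ∑ (∑∑perms (insertʳ y h)) (splits (suc j) ys)
    ≡⟨ ∑∑perms-splits-∷ y h j ys ⟨
  ∑ (∑∑perms h) (splits (suc j) (y ∷ ys))
    ∎
  where
  open ≡-Reasoning
  |ys|≤j = ℕ.≤-pred (ℕ.≰⇒> j≮|ys|)

insertAll-map : (f : X → Y) (y : X) (p : List X) →
  insertAll (f y) (map f p) ≡ map (map f) (insertAll y p)
insertAll-map f y [] = refl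
insertAll-map f y (x ∷ p) = cong ((f y ∷ f x ∷ map f p) ∷_) (begin
  map (f x ∷_) (insertAll (f y) (map f p))     ≡⟨ cong (map (f x ∷_)) (insertAll-map f y p) ⟩
  map (f x ∷_) (map (map f) (insertAll y p))   ≡⟨ List.map-∘ (insertAll y p) ⟨
  map (map f ∘ (x ∷_)) (insertAll y p)         ≡⟨ List.map-∘ (insertAll y p) ⟩
  map (map f) (map (x ∷_) (insertAll y p))     ∎)
  where open ≡-Reasoning

perms-map : (f : X → Y) (xs : List X) → perms (map f xs) ≡ map (map f) (perms xs)
perms-map f [] = refl
perms-map f (y ∷ xs) = begin
  concatMap (insertAll (f y)) (perms (map f xs))        ≡⟨ cong (concatMap (insertAll (f y))) (perms-map f xs) ⟩
  concatMap (insertAll (f y)) (map (map f) (perms xs))  ≡⟨ List.concatMap-map (insertAll (f y)) (map f) (perms xs) ⟩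
  concatMap (insertAll (f y) ∘ map f) (perms xs)        ≡⟨ List.concatMap-cong (insertAll-map f y) (perms xs) ⟩
  concatMap (map (map f) ∘ insertAll y) (perms xs)      ≡⟨ List.map-concatMap (map f) (insertAll y) (perms xs) ⟨
  map (map f) (concatMap (insertAll y) (perms xs))      ∎
  where open ≡-Reasoning

-- Relabelling by order embeddings

AscendingFrom : ℕ → List ℕ → Set
AscendingFrom b [] = ⊤
AscendingFrom b (x ∷ xs) = b < x × AscendingFrom x xs

AscendingFrom-weaken : ∀ {a b} xs → a ≤ b → AscendingFrom b xs → AscendingFrom a xs
AscendingFrom-weaken [] _ _ = tt
AscendingFrom-weaken (x ∷ xs) a≤b (b<x , asc) = ℕ.≤-<-trans a≤b b<x , asc

splits-lengths : ∀ j (xs : List X) →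
  All (λ (a , b) → length a ≡ j × length b ℕ.+ j ≡ length xs) (splits j xs)
splits-lengths zero xs = (refl , ℕ.+-identityʳ _) ∷ []
splits-lengths (suc j) [] = []
splits-lengths (suc j) (y ∷ ys) =
  ++⁺ (map⁺ (All.map (λ (|a| , |b|) → cong suc |a| , trans (ℕ.+-suc _ j) (cong suc |b|)) (splits-lengths j ys)))
      (map⁺ (All.map (λ (|a| , |b|) → |a| , cong suc |b|) (splits-lengths (suc j) ys)))

splits-ascending : ∀ j xs {c} → AscendingFrom c xs →
  All (λ (a , b) → AscendingFrom c a × AscendingFrom c b) (splits j xs)
splits-ascending zero xs asc = (tt , asc) ∷ []
splits-ascending (suc j) [] _ = []
splits-ascending (suc j) (y ∷ ys) (c<y , asc) =
  ++⁺ (map⁺ (All.map (λ (a↑ , b↑) → (c<y , a↑) , weaken b↑) (splits-ascending j ys asc)))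
      (map⁺ (All.map (λ (a↑ , b↑) → weaken a↑ , (c<y , b↑)) (splits-ascending (suc j) ys asc)))
  where
  weaken : ∀ {zs} → AscendingFrom y zs → AscendingFrom _ zs
  weaken {zs} = AscendingFrom-weaken zs (ℕ.<⇒≤ c<y)

OrderEmbedding : (ℕ → ℕ) → Set
OrderEmbedding f = ∀ i j → (f i <ᵇ f j) ≡ (i <ᵇ j)

<⇒<ᵇ≡true : ∀ {m n} → m < n → (m <ᵇ n) ≡ true
<⇒<ᵇ≡true {zero} {suc n} _ = refl
<⇒<ᵇ≡true {suc m} {suc n} (s≤s m<n) = <⇒<ᵇ≡true m<n

≤⇒>ᵇ≡false : ∀ {m n} → n ≤ m → (m <ᵇ n) ≡ false
≤⇒>ᵇ≡false {m} {zero} _ = refl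
≤⇒>ᵇ≡false {suc m} {suc n} (s≤s n≤m) = ≤⇒>ᵇ≡false n≤m

strictlyMonotone⇒OrderEmbedding : (f : ℕ → ℕ) → (∀ {i j} → i < j → f i < f j) → OrderEmbedding f
strictlyMonotone⇒OrderEmbedding f mono i j with ℕ.<-cmp i j
... | tri< i<j _ _ = trans (<⇒<ᵇ≡true (mono i<j)) (sym (<⇒<ᵇ≡true i<j))
... | tri≈ _ refl _ = trans (≤⇒>ᵇ≡false {f i} ℕ.≤-refl) (sym (≤⇒>ᵇ≡false {i} ℕ.≤-refl))
... | tri> _ _ j<i = trans (≤⇒>ᵇ≡false (ℕ.<⇒≤ (mono j<i))) (sym (≤⇒>ᵇ≡false (ℕ.<⇒≤ j<i)))

suc-increasing⇒strictlyMonotone : (f : ℕ → ℕ) → (∀ i → f i < f (suc i)) → ∀ {i j} → i < j → f i < f j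
suc-increasing⇒strictlyMonotone f step {i} {suc j} (s≤s i≤j) with ℕ.m≤n⇒m<n∨m≡n i≤j
... | inj₁ i<j = ℕ.<-trans (suc-increasing⇒strictlyMonotone f step i<j) (step j)
... | inj₂ refl = step i

embedding : ℕ → List ℕ → ℕ → ℕ
embedding b [] i = b ℕ.+ i
embedding b (x ∷ xs) zero = b
embedding b (x ∷ xs) (suc i) = embedding x xs i

embedding-0 : ∀ b xs → embedding b xs 0 ≡ b
embedding-0 b [] = ℕ.+-identityʳ b
embedding-0 b (x ∷ xs) = refl

embedding-OrderEmbedding : ∀ b xs → AscendingFrom b xs → OrderEmbedding (embedding b xs)
embedding-OrderEmbedding b xs asc =
  strictlyMonotone⇒OrderEmbedding (embedding b xs)
    (suc-increasing⇒strictlyMonotone (embedding b xs) (step b xs asc))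
  where
  step : ∀ b xs → AscendingFrom b xs → ∀ i → embedding b xs i < embedding b xs (suc i)
  step b [] _ i = ℕ.+-monoʳ-< b (ℕ.n<1+n i)
  step b (x ∷ xs) (b<x , _) zero = subst (b <_) (sym (embedding-0 x xs)) b<x
  step b (x ∷ xs) (_ , asc) (suc i) = step x xs asc i

map-embedding-labels : ∀ xs → map (embedding 0 xs) (labels (length xs)) ≡ xs
map-embedding-labels xs =
  trans (sym (List.map-∘ (upTo (length xs))))
  (trans (List.map-upTo (embedding 0 xs ∘ suc) (length xs)) (tail-embedding 0 xs))
  where
  tail-embedding : ∀ b xs → applyUpTo (embedding b xs ∘ suc) (length xs) ≡ xs
  tail-embedding b [] = refl
  tail-embedding b (x ∷ xs) = cong₂ _∷_ (embedding-0 x xs) (tail-embedding x xs)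

labels-ascending : ∀ m → AscendingFrom 0 (labels m)
labels-ascending m =
  subst (AscendingFrom 0) (sym (List.map-upTo suc m)) (ascending suc 0 (s≤s z≤n) (λ i → ℕ.n<1+n (suc i)) m)
  where
  ascending : ∀ (g : ℕ → ℕ) k → k < g 0 → (∀ i → g i < g (suc i)) → ∀ m → AscendingFrom k (applyUpTo g m)
  ascending g k _ _ zero = tt
  ascending g k k<g0 step (suc m) = k<g0 , ascending (g ∘ suc) (g 0) (step 0) (step ∘ suc) m

length-labels : ∀ m → length (labels m) ≡ m
length-labels m = trans (List.length-map suc (upTo m)) (List.length-upTo m)

∑-perms-relabel : (φ : List ℕ → ℚ) → (∀ f → OrderEmbedding f → ∀ p → φ (map f p) ≡ φ p) →
  ∀ xs → AscendingFrom 0 xs → ∑ φ (perms xs) ≡ ∑ φ (perms (labels (length xs)))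
∑-perms-relabel φ φ-inv xs asc = begin
  ∑ φ (perms xs)                    ≡⟨ cong (∑ φ ∘ perms) (map-embedding-labels xs) ⟨
  ∑ φ (perms (map e ls))            ≡⟨ cong (∑ φ) (perms-map e ls) ⟩
  ∑ φ (map (map e) (perms ls))      ≡⟨ ∑-map φ (map e) (perms ls) ⟩
  ∑ (φ ∘ map e) (perms ls)          ≡⟨ ∑-cong (φ-inv e (embedding-OrderEmbedding 0 xs asc)) (perms ls) ⟩
  ∑ φ (perms ls)                    ∎
  where
  open ≡-Reasoning
  e = embedding 0 xs
  ls = labels (length xs)

mapShrub : (ℕ → ℕ) → Shrub → Shrub
mapShrub f (a , b , c) = (f a , f b , f c)

chunk3-map : (f : ℕ → ℕ) (p : List ℕ) → chunk3 (map f p) ≡ map (mapShrub f) (chunk3 p)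
chunk3-map f [] = refl
chunk3-map f (a ∷ []) = refl
chunk3-map f (a ∷ b ∷ []) = refl
chunk3-map f (a ∷ b ∷ c ∷ p) = cong ((f a , f b , f c) ∷_) (chunk3-map f p)

module Relabel (f : ℕ → ℕ) (f-emb : OrderEmbedding f) where

  isShrub-relabel : ∀ s → isShrub (mapShrub f s) ≡ isShrub s
  isShrub-relabel (a , b , c) rewrite f-emb a b | f-emb a c = refl

  <[_]-relabel : ∀ z s t → (mapShrub f s <[ z ] mapShrub f t) ≡ (s <[ z ] t)
  <[ T ]-relabel (a , b , c) (d , e , g)
    rewrite f-emb a d | f-emb a e | f-emb a g | f-emb b d | f-emb b e | f-emb b g
          | f-emb c d | f-emb c e | f-emb c g = refl
  <[ B ]-relabel (a , b , c) (d , e , g) rewrite f-emb a d = refl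
  <[ L ]-relabel (a , b , c) (d , e , g) rewrite f-emb a d | f-emb b e | f-emb c g = refl
  <[ A ]-relabel (a , b , c) (d , e , g) rewrite f-emb c e = refl

  allShrubs-relabel : ∀ F → allShrubs (map (mapShrub f) F) ≡ allShrubs F
  allShrubs-relabel [] = refl
  allShrubs-relabel (s ∷ F) = cong₂ _∧_ (isShrub-relabel s) (allShrubs-relabel F)

  ris-relabel : ∀ z F → ris z (map (mapShrub f) F) ≡ ris z F
  ris-relabel z [] = refl
  ris-relabel z (s ∷ []) = refl
  ris-relabel z (s ∷ t ∷ F) =
    cong₂ (λ b r → (if b then 1 else 0) ℕ.+ r) (<[ z ]-relabel s t) (ris-relabel z (t ∷ F))

  increasing-relabel : ∀ z F → increasing z (map (mapShrub f) F) ≡ increasing z F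
  increasing-relabel z [] = refl
  increasing-relabel z (s ∷ []) = refl
  increasing-relabel z (s ∷ t ∷ F) = cong₂ _∧_ (<[ z ]-relabel s t) (increasing-relabel z (t ∷ F))

-- Weights of forests

risWeight : Z → ℚ → List Shrub → ℚ
risWeight z x F = 𝟙 (allShrubs F) * pow x (ris z F)

incWeight : Z → List Shrub → ℚ
incWeight z F = 𝟙 (allShrubs F) * 𝟙 (increasing z F)

module _ (f : ℕ → ℕ) (f-emb : OrderEmbedding f) where
  open Relabel f f-emb

  risWeight-relabel : ∀ z x p → risWeight z x (chunk3 (map f p)) ≡ risWeight z x (chunk3 p)
  risWeight-relabel z x p
    rewrite chunk3-map f p | allShrubs-relabel (chunk3 p) | ris-relabel z (chunk3 p) = refl

  incWeight-relabel : ∀ z p → incWeight z (chunk3 (map f p)) ≡ incWeight z (chunk3 p)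
  incWeight-relabel z p
    rewrite chunk3-map f p | allShrubs-relabel (chunk3 p) | increasing-relabel z (chunk3 p) = refl

1+[x-1]≡x : ∀ x → 1ℚ + (x - 1ℚ) ≡ x
1+[x-1]≡x x = begin
  1ℚ + (x - 1ℚ)    ≡⟨ ℚ.+-comm 1ℚ (x - 1ℚ) ⟩
  (x - 1ℚ) + 1ℚ    ≡⟨ ℚ.+-assoc x (- 1ℚ) 1ℚ ⟩
  x + (- 1ℚ + 1ℚ)  ≡⟨ cong (x +_) (ℚ.+-inverseˡ 1ℚ) ⟩
  x + 0ℚ           ≡⟨ ℚ.+-identityʳ x ⟩
  x                ∎
  where open ≡-Reasoning

pow-ris-∷∷ : ∀ z x s t F →
  pow x (ris z (s ∷ t ∷ F)) ≡ (1ℚ + 𝟙 (s <[ z ] t) * (x - 1ℚ)) * pow x (ris z (t ∷ F))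
pow-ris-∷∷ z x s t F with s <[ z ] t
... | true = cong (_* pow x (ris z (t ∷ F))) (sym (trans (cong (1ℚ +_) (ℚ.*-identityˡ (x - 1ℚ))) (1+[x-1]≡x x)))
... | false = sym (trans (cong (λ c → (1ℚ + c) * pow x (ris z (t ∷ F))) (ℚ.*-zeroˡ (x - 1ℚ))) (ℚ.*-identityˡ _))

expansionTerm : Z → ℚ → List Shrub → ℕ → ℚ
expansionTerm z x F k =
  pow (x - 1ℚ) k * (𝟙 (increasing z (take (suc k) F)) * pow x (ris z (drop (suc k) F)))

expansionTerm-suc : ∀ z x s t F k →
  expansionTerm z x (s ∷ t ∷ F) (suc k) ≡ (𝟙 (s <[ z ] t) * (x - 1ℚ)) * expansionTerm z x (t ∷ F) k
expansionTerm-suc z x s t F k =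
  trans (cong (λ c → ((x - 1ℚ) * pow (x - 1ℚ) k) * (c * pow x (ris z (drop k F))))
              (𝟙-∧ (s <[ z ] t) (increasing z (t ∷ take k F))))
        (reassoc (x - 1ℚ) (pow (x - 1ℚ) k) (𝟙 (s <[ z ] t)) _ _)
  where
  reassoc : ∀ q qᵏ b i r → (q * qᵏ) * ((b * i) * r) ≡ (b * q) * (qᵏ * (i * r))
  reassoc = solve-∀ ℚ-ring

pow-ris-expansion : ∀ z x s F → pow x (ris z (s ∷ F)) ≡ ∑< (length (s ∷ F)) (expansionTerm z x (s ∷ F))
pow-ris-expansion z x s [] = refl
pow-ris-expansion z x s (t ∷ F) = begin
  pow x (ris z (s ∷ t ∷ F))
    ≡⟨ pow-ris-∷∷ z x s t F ⟩
  (1ℚ + c) * W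
    ≡⟨ split c W ⟩
  1ℚ * (1ℚ * W) + c * W
    ≡⟨ cong (λ e → 1ℚ * (1ℚ * W) + c * e) (pow-ris-expansion z x t F) ⟩
  1ℚ * (1ℚ * W) + c * ∑< n (expansionTerm z x (t ∷ F))
    ≡⟨ cong (1ℚ * (1ℚ * W) +_) (∑<-*ˡ n c (expansionTerm z x (t ∷ F))) ⟨
  1ℚ * (1ℚ * W) + ∑< n (λ k → c * expansionTerm z x (t ∷ F) k)
    ≡⟨ cong (1ℚ * (1ℚ * W) +_) (∑<-cong n (λ k _ → sym (expansionTerm-suc z x s t F k))) ⟩
  ∑< (suc n) (expansionTerm z x (s ∷ t ∷ F))
    ∎
  where
  open ≡-Reasoning
  c = 𝟙 (s <[ z ] t) * (x - 1ℚ)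
  W = pow x (ris z (t ∷ F))
  n = length (t ∷ F)
  split : ∀ c w → (1ℚ + c) * w ≡ 1ℚ * (1ℚ * w) + c * w
  split = solve-∀ ℚ-ring

allShrubs-take-drop : ∀ j F → allShrubs F ≡ allShrubs (take j F) ∧ allShrubs (drop j F)
allShrubs-take-drop zero F = refl
allShrubs-take-drop (suc j) [] = refl
allShrubs-take-drop (suc j) (s ∷ F) =
  trans (cong (isShrub s ∧_) (allShrubs-take-drop j F)) (sym (∧-assoc (isShrub s) _ _))

risWeight-expansion : ∀ z x s F → risWeight z x (s ∷ F) ≡
  ∑< (length (s ∷ F)) (λ k → pow (x - 1ℚ) k *
                               (incWeight z (take (suc k) (s ∷ F)) * risWeight z x (drop (suc k) (s ∷ F))))
risWeight-expansion z x s F =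
  trans (cong (𝟙 (allShrubs G) *_) (pow-ris-expansion z x s F))
  (trans (sym (∑<-*ˡ (length G) (𝟙 (allShrubs G)) (expansionTerm z x G)))
         (∑<-cong (length G) (λ k _ → distribute k)))
  where
  G = s ∷ F
  reassoc : ∀ a d q i r → (a * d) * (q * (i * r)) ≡ q * ((a * i) * (d * r))
  reassoc = solve-∀ ℚ-ring
  distribute : ∀ k → 𝟙 (allShrubs G) * expansionTerm z x G k ≡
    pow (x - 1ℚ) k * (incWeight z (take (suc k) G) * risWeight z x (drop (suc k) G))
  distribute k =
    trans (cong (_* expansionTerm z x G k)
                (trans (cong 𝟙 (allShrubs-take-drop (suc k) G)) (𝟙-∧ (allShrubs (take (suc k) G)) _)))
          (reassoc (𝟙 (allShrubs (take (suc k) G))) (𝟙 (allShrubs (drop (suc k) G))) (pow (x - 1ℚ) k)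
                   (𝟙 (increasing z (take (suc k) G))) (pow x (ris z (drop (suc k) G))))

-- Multiples of three

triple : ℕ → ℕ
triple zero = zero
triple (suc n) = suc (suc (suc (triple n)))

triple≡3* : ∀ n → triple n ≡ 3 ℕ.* n
triple≡3* zero = refl
triple≡3* (suc n) = trans (cong (λ m → suc (suc (suc m))) (triple≡3* n)) (sym (ℕ.*-suc 3 n))

triple-∸ : ∀ m n → triple m ∸ triple n ≡ triple (m ∸ n)
triple-∸ m zero = refl
triple-∸ zero (suc n) = refl
triple-∸ (suc m) (suc n) = triple-∸ m n

triple-mono-≤ : ∀ {m n} → m ≤ n → triple m ≤ triple n
triple-mono-≤ z≤n = z≤n
triple-mono-≤ (s≤s m≤n) = s≤s (s≤s (s≤s (triple-mono-≤ m≤n)))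

data Mod3 : ℕ → Set where
  3k   : ∀ k → Mod3 (triple k)
  3k+1 : ∀ k → Mod3 (suc (triple k))
  3k+2 : ∀ k → Mod3 (suc (suc (triple k)))

mod3 : ∀ m → Mod3 m
mod3 zero = 3k zero
mod3 (suc m) with mod3 m
... | 3k k = 3k+1 k
... | 3k+1 k = 3k+2 k
... | 3k+2 k = 3k (suc k)

∑<-triple : ∀ n (f : ℕ → ℚ) →
  ∑< (triple n) f ≡ ∑< n (λ k → f (triple k) + (f (suc (triple k)) + f (suc (suc (triple k)))))
∑<-triple zero f = refl
∑<-triple (suc n) f =
  trans (cong (λ s → f 0 + (f 1 + (f 2 + s))) (∑<-triple n (λ i → f (suc (suc (suc i))))))
        (reassoc (f 0) (f 1) (f 2) _)
  where
  reassoc : ∀ a b c d → a + (b + (c + d)) ≡ (a + (b + c)) + d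
  reassoc = solve-∀ ℚ-ring

take-chunk3 : ∀ j p → take j (chunk3 p) ≡ chunk3 (take (triple j) p)
take-chunk3 zero p = refl
take-chunk3 (suc j) [] = refl
take-chunk3 (suc j) (a ∷ []) = refl
take-chunk3 (suc j) (a ∷ b ∷ []) = refl
take-chunk3 (suc j) (a ∷ b ∷ c ∷ p) = cong ((a , b , c) ∷_) (take-chunk3 j p)

drop-chunk3 : ∀ j p → drop j (chunk3 p) ≡ chunk3 (drop (triple j) p)
drop-chunk3 zero p = refl
drop-chunk3 (suc j) [] = refl
drop-chunk3 (suc j) (a ∷ []) = refl
drop-chunk3 (suc j) (a ∷ b ∷ []) = refl
drop-chunk3 (suc j) (a ∷ b ∷ c ∷ p) = drop-chunk3 j p

length-chunk3 : ∀ n p → length p ≡ triple n → length (chunk3 p) ≡ n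
length-chunk3 zero [] _ = refl
length-chunk3 (suc n) (a ∷ b ∷ c ∷ p) |p|≡ =
  cong suc (length-chunk3 n p (ℕ.suc-injective (ℕ.suc-injective (ℕ.suc-injective |p|≡))))

splitWeight : Z → ℚ → List ℕ → List ℕ → ℚ
splitWeight z x a b = incWeight z (chunk3 a) * risWeight z x (chunk3 b)

risWeight-chunk3-expansion : ∀ z x n p → length p ≡ triple (suc n) →
  risWeight z x (chunk3 p) ≡ ∑< (suc n) (λ k → pow (x - 1ℚ) k * atCut (triple (suc k)) (splitWeight z x) p)
risWeight-chunk3-expansion z x n p@(a ∷ b ∷ c ∷ r) |p|≡ =
  trans (risWeight-expansion z x (a , b , c) (chunk3 r))
  (trans (cong (λ m → ∑< (suc m) (term (chunk3 p)))
               (length-chunk3 n r (ℕ.suc-injective (ℕ.suc-injective (ℕ.suc-injective |p|≡)))))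
         (∑<-cong (suc n) (λ k _ → cong₂ (λ u v → pow (x - 1ℚ) k * (incWeight z u * risWeight z x v))
                                          (take-chunk3 (suc k) p) (drop-chunk3 (suc k) p))))
  where
  term : List Shrub → ℕ → ℚ
  term F k = pow (x - 1ℚ) k * (incWeight z (take (suc k) F) * risWeight z x (drop (suc k) F))

risSum : Z → ℚ → List ℕ → ℚ
risSum z x ls = ∑ (risWeight z x ∘ chunk3) (perms ls)

incSum : Z → List ℕ → ℚ
incSum z ls = ∑ (incWeight z ∘ chunk3) (perms ls)

∑-perms-splitWeight : ∀ z x j ls → AscendingFrom 0 ls → j ≤ length ls →
  ∑ (atCut j (splitWeight z x)) (perms ls) ≡
  fromℕ (length ls C j) * (incSum z (labels j) * risSum z x (labels (length ls ∸ j)))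
∑-perms-splitWeight z x j ls asc j≤|ls| = begin
  ∑ (atCut j (splitWeight z x)) (perms ls)       ≡⟨ ∑-perms-atCut j ls (splitWeight z x) j≤|ls| ⟩
  ∑ (∑∑perms (splitWeight z x)) (splits j ls)
    ≡⟨ ∑-congᴬ (All.zipWith part-sum (splits-lengths j ls , splits-ascending j ls asc)) ⟩
  ∑ (λ _ → c) (splits j ls)                      ≡⟨ ∑-const c (splits j ls) ⟩
  fromℕ (length (splits j ls)) * c               ≡⟨ cong (λ m → fromℕ m * c) (length-splits j ls) ⟩
  fromℕ (length ls C j) * c                      ∎
  where
  open ≡-Reasoning
  c = incSum z (labels j) * risSum z x (labels (length ls ∸ j))
  part-sum : ∀ {ab} → (length (proj₁ ab) ≡ j × length (proj₂ ab) ℕ.+ j ≡ length ls) ×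
                      (AscendingFrom 0 (proj₁ ab) × AscendingFrom 0 (proj₂ ab)) →
             ∑∑perms (splitWeight z x) ab ≡ c
  part-sum {a , b} ((|a| , |b|+j) , (a↑ , b↑)) =
    trans (∑-*-∑ (incWeight z ∘ chunk3) (risWeight z x ∘ chunk3) (perms a) (perms b))
    (cong₂ _*_ (trans (∑-perms-relabel _ (λ f f-emb → incWeight-relabel f f-emb z) a a↑)
                      (cong (incSum z ∘ labels) |a|))
               (trans (∑-perms-relabel _ (λ f f-emb → risWeight-relabel f f-emb z x) b b↑)
                      (cong (risSum z x ∘ labels) (trans (sym (ℕ.m+n∸n≡m _ j)) (cong (_∸ j) |b|+j)))))

risSum-recurrence : ∀ z x n → risSum z x (labels (triple (suc n))) ≡
  ∑< (suc n) (λ k → pow (x - 1ℚ) k * (fromℕ (triple (suc n) C triple (suc k)) *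
                    (incSum z (labels (triple (suc k))) * risSum z x (labels (triple (n ∸ k))))))
risSum-recurrence z x n = begin
  ∑ (risWeight z x ∘ chunk3) (perms ls)
    ≡⟨ ∑-congᴬ (All.map (λ {p} |p|≡ → risWeight-chunk3-expansion z x n p (trans |p|≡ (length-labels N)))
                        (length-perms ls)) ⟩
  ∑ (λ p → ∑< (suc n) (λ k → term k p)) (perms ls)
    ≡⟨ ∑-∑<-comm (suc n) term (perms ls) ⟩
  ∑< (suc n) (λ k → ∑ (term k) (perms ls))
    ≡⟨ ∑<-cong (suc n) (λ k k<1+n → trans (∑-*ˡ (pow (x - 1ℚ) k) _ (perms ls))
                                           (cong (pow (x - 1ℚ) k *_) (count k (ℕ.≤-pred k<1+n)))) ⟩
  ∑< (suc n) (λ k → pow (x - 1ℚ) k * (fromℕ (N C triple (suc k)) *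
                    (incSum z (labels (triple (suc k))) * risSum z x (labels (triple (n ∸ k))))))
    ∎
  where
  open ≡-Reasoning
  N = triple (suc n)
  ls = labels N
  term : ℕ → List ℕ → ℚ
  term k p = pow (x - 1ℚ) k * atCut (triple (suc k)) (splitWeight z x) p
  count : ∀ k → k ≤ n → ∑ (atCut (triple (suc k)) (splitWeight z x)) (perms ls) ≡
    fromℕ (N C triple (suc k)) * (incSum z (labels (triple (suc k))) * risSum z x (labels (triple (n ∸ k))))
  count k k≤n = begin
    ∑ (atCut j (splitWeight z x)) (perms ls)
      ≡⟨ ∑-perms-splitWeight z x j ls (labels-ascending N)
           (subst (j ≤_) (sym (length-labels N)) (triple-mono-≤ (s≤s k≤n))) ⟩
    fromℕ (length ls C j) * (incSum z (labels j) * risSum z x (labels (length ls ∸ j)))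
      ≡⟨ cong (λ m → fromℕ (m C j) * (incSum z (labels j) * risSum z x (labels (m ∸ j)))) (length-labels N) ⟩
    fromℕ (N C j) * (incSum z (labels j) * risSum z x (labels (N ∸ j)))
      ≡⟨ cong (λ m → fromℕ (N C j) * (incSum z (labels j) * risSum z x (labels m))) (triple-∸ (suc n) (suc k)) ⟩
    fromℕ (N C j) * (incSum z (labels j) * risSum z x (labels (triple (n ∸ k))))
      ∎
    where j = triple (suc k)

-- Formal power series

*S-oneSʳ : ∀ f m → (f *S oneS) m ≡ f m
*S-oneSʳ f m = begin
  ∑ (λ i → f i * oneS (m ∸ i)) (upTo (suc m))       ≡⟨ ∑-upTo (λ i → f i * oneS (m ∸ i)) (suc m) ⟩
  ∑< (suc m) (λ i → f i * oneS (m ∸ i))             ≡⟨ ∑<-sucʳ m (λ i → f i * oneS (m ∸ i)) ⟩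
  ∑< m (λ i → f i * oneS (m ∸ i)) + f m * oneS (m ∸ m)
    ≡⟨ cong₂ _+_ (trans (∑<-cong m off-diagonal) (∑<-0 m))
                 (trans (cong (λ k → f m * oneS k) (ℕ.n∸n≡0 m)) (ℚ.*-identityʳ (f m))) ⟩
  0ℚ + f m                                          ≡⟨ ℚ.+-identityˡ (f m) ⟩
  f m                                               ∎
  where
  open ≡-Reasoning
  off-diagonal : ∀ i → i < m → f i * oneS (m ∸ i) ≡ 0ℚ
  off-diagonal i i<m = trans (cong (λ k → f i * oneS k) (ℕ.+-∸-assoc 1 i<m)) (ℚ.*-zeroʳ (f i))

*S--S : ∀ f g h m → (f *S (g -S h)) m ≡ (f *S g) m - (f *S h) m
*S--S f g h m = begin
  ∑ (λ i → f i * (g (m ∸ i) - h (m ∸ i))) (upTo (suc m))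
    ≡⟨ ∑-cong distrib (upTo (suc m)) ⟩
  ∑ (λ i → f i * g (m ∸ i) + - (f i * h (m ∸ i))) (upTo (suc m))
    ≡⟨ ∑-+ (λ i → f i * g (m ∸ i)) (λ i → - (f i * h (m ∸ i))) (upTo (suc m)) ⟩
  (f *S g) m + ∑ (λ i → - (f i * h (m ∸ i))) (upTo (suc m))
    ≡⟨ cong ((f *S g) m +_) (∑-neg (λ i → f i * h (m ∸ i)) (upTo (suc m))) ⟩
  (f *S g) m - (f *S h) m
    ∎
  where
  open ≡-Reasoning
  distrib : ∀ i → f i * (g (m ∸ i) - h (m ∸ i)) ≡ f i * g (m ∸ i) + - (f i * h (m ∸ i))
  distrib i = trans (ℚ.*-distribˡ-+ (f i) _ _) (cong (f i * g (m ∸ i) +_) (sym (ℚ.neg-distribʳ-* (f i) _)))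

OnTriples : FPS → Set
OnTriples f = ∀ k → f (suc (triple k)) ≡ 0ℚ × f (suc (suc (triple k))) ≡ 0ℚ

triple≤2+triple⇒≤ : ∀ a c → triple a ≤ suc (suc (triple c)) → a ≤ c
triple≤2+triple⇒≤ zero c _ = z≤n
triple≤2+triple⇒≤ (suc a) zero (s≤s (s≤s ()))
triple≤2+triple⇒≤ (suc a) (suc c) (s≤s (s≤s (s≤s le))) = s≤s (triple≤2+triple⇒≤ a c le)

*S-triple : ∀ f g → OnTriples f → ∀ c →
  (f *S g) (triple c) ≡ ∑< (suc c) (λ a → f (triple a) * g (triple (c ∸ a)))
*S-triple f g f-on c = begin
  ∑ h (upTo (suc (triple c)))
    ≡⟨ ∑-upTo h (suc (triple c)) ⟩
  ∑< (suc (triple c)) h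
    ≡⟨ ∑<-sucʳ (triple c) h ⟩
  ∑< (triple c) h + h (triple c)
    ≡⟨ cong (_+ h (triple c)) (∑<-triple c h) ⟩
  ∑< c (λ a → h (triple a) + (h (suc (triple a)) + h (suc (suc (triple a))))) + h (triple c)
    ≡⟨ cong (_+ h (triple c)) (∑<-cong c (λ a _ → only-triples a)) ⟩
  ∑< c (λ a → h (triple a)) + h (triple c)
    ≡⟨ ∑<-sucʳ c (h ∘ triple) ⟨
  ∑< (suc c) (h ∘ triple)
    ≡⟨ ∑<-cong (suc c) (λ a _ → cong (λ i → f (triple a) * g i) (triple-∸ c a)) ⟩
  ∑< (suc c) (λ a → f (triple a) * g (triple (c ∸ a)))
    ∎
  where
  open ≡-Reasoning
  h : ℕ → ℚ
  h i = f i * g (triple c ∸ i)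
  vanish : ∀ {i} → f i ≡ 0ℚ → h i ≡ 0ℚ
  vanish {i} fi≡0 = trans (cong (_* g (triple c ∸ i)) fi≡0) (ℚ.*-zeroˡ (g (triple c ∸ i)))
  only-triples : ∀ a → h (triple a) + (h (suc (triple a)) + h (suc (suc (triple a)))) ≡ h (triple a)
  only-triples a = trans (cong (h (triple a) +_) (cong₂ _+_ (vanish (proj₁ (f-on a))) (vanish (proj₂ (f-on a)))))
                         (ℚ.+-identityʳ (h (triple a)))

*S-OnTriples : ∀ f g → OnTriples f → OnTriples g → OnTriples (f *S g)
*S-OnTriples f g f-on g-on c = vanishes 1 (s≤s z≤n) (proj₁ ∘ g-on) , vanishes 2 ℕ.≤-refl (proj₂ ∘ g-on)
  where
  vanishes : ∀ r → r ≤ 2 → (∀ k → g (r ℕ.+ triple k) ≡ 0ℚ) → (f *S g) (r ℕ.+ triple c) ≡ 0ℚ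
  vanishes r r≤2 g-off =
    trans (∑-upTo h (suc m)) (trans (∑<-cong (suc m) (λ i i≤m → term (mod3 i) i≤m)) (∑<-0 (suc m)))
    where
    m = r ℕ.+ triple c
    h : ℕ → ℚ
    h i = f i * g (m ∸ i)
    term : ∀ {i} → Mod3 i → i < suc m → h i ≡ 0ℚ
    term (3k a) (s≤s 3a≤m) = trans (cong (f (triple a) *_) g-zero) (ℚ.*-zeroʳ (f (triple a)))
      where
      a≤c = triple≤2+triple⇒≤ a c (ℕ.≤-trans 3a≤m (ℕ.+-monoˡ-≤ (triple c) r≤2))
      g-zero : g (m ∸ triple a) ≡ 0ℚ
      g-zero = trans (cong g (trans (ℕ.+-∸-assoc r (triple-mono-≤ a≤c)) (cong (r ℕ.+_) (triple-∸ c a))))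
                     (g-off (c ∸ a))
    term (3k+1 a) _ = trans (cong (_* g (m ∸ suc (triple a))) (proj₁ (f-on a)))
                            (ℚ.*-zeroˡ (g (m ∸ suc (triple a))))
    term (3k+2 a) _ = trans (cong (_* g (m ∸ suc (suc (triple a)))) (proj₂ (f-on a)))
                            (ℚ.*-zeroˡ (g (m ∸ suc (suc (triple a)))))

-- The local function go of egf3, restated so that its two cases can be used by name.
egf3-coefficient : (ℕ → ℚ) → ℕ → ℕ → ℚ
egf3-coefficient c k zero = c (k ℕ./ 3) * 1/! k
egf3-coefficient c k (suc _) = 0ℚ

egf3-suc : ∀ c m → egf3 c (suc m) ≡ egf3-coefficient c (suc m) (suc m ℕ.% 3)
egf3-suc c m with suc m ℕ.% 3
... | zero = refl
... | suc _ = refl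

triple≡*3 : ∀ k → triple k ≡ k ℕ.* 3
triple≡*3 k = trans (triple≡3* k) (ℕ.*-comm 3 k)

egf3-triple : ∀ c k → egf3 c (triple (suc k)) ≡ c (suc k) * 1/! (triple (suc k))
egf3-triple c k = begin
  egf3 c N
    ≡⟨ egf3-suc c (suc (suc (triple k))) ⟩
  egf3-coefficient c N (N ℕ.% 3)
    ≡⟨ cong (egf3-coefficient c N) (trans (cong (ℕ._% 3) (triple≡*3 (suc k))) (ℕ.m*n%n≡0 (suc k) 3)) ⟩
  c (N ℕ./ 3) * 1/! N
    ≡⟨ cong (λ n → c n * 1/! N) (trans (cong (ℕ._/ 3) (triple≡*3 (suc k))) (ℕ.m*n/n≡m (suc k) 3)) ⟩
  c (suc k) * 1/! N
    ∎
  where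
  open ≡-Reasoning
  N = triple (suc k)

egf3-OnTriples : ∀ c → OnTriples (egf3 c)
egf3-OnTriples c k = off 0 refl , off 1 refl
  where
  off : ∀ r → suc r ℕ.% 3 ≡ suc r → egf3 c (suc r ℕ.+ triple k) ≡ 0ℚ
  off r small = trans (egf3-suc c (r ℕ.+ triple k))
    (cong (egf3-coefficient c (suc r ℕ.+ triple k))
          (trans (cong (λ n → (suc r ℕ.+ n) ℕ.% 3) (triple≡*3 k)) (trans (ℕ.[m+kn]%n≡m%n (suc r) k 3) small)))

nCk*k!*[n∸k]!≡n! : ∀ n k → k ≤ n → (n C k) ℕ.* (k ! ℕ.* (n ∸ k) !) ≡ n !
nCk*k!*[n∸k]!≡n! n k k≤n =
  trans (cong (ℕ._* (k ! ℕ.* (n ∸ k) !)) (nCk≡n!/k![n-k]! k≤n))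
        (ℕ.m/n*n≡m {{k ℕ.!* (n ∸ k) !≢0}} (k![n∸k]!∣n! k≤n))

1/!-binomial : ∀ n k → k ≤ n → 1/! n * fromℕ (n C k) ≡ 1/! k * 1/! (n ∸ k)
1/!-binomial n k k≤n = begin
  u * c                             ≡⟨ ℚ.*-identityʳ (u * c) ⟨
  (u * c) * 1ℚ                      ≡⟨ cong ((u * c) *_) k!l!/k!l!≡1 ⟨
  (u * c) * ((fk * vk) * (fl * vl)) ≡⟨ reassoc u c fk vk fl vl ⟩
  (u * (c * (fk * fl))) * (vk * vl) ≡⟨ cong (λ w → (u * w) * (vk * vl)) n!-factored ⟩
  (u * fromℕ (n !)) * (vk * vl)     ≡⟨ cong (_* (vk * vl)) (1/ℕ-inverseˡ (n !) {{n ℕ.!≢0}}) ⟩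
  1ℚ * (vk * vl)                    ≡⟨ ℚ.*-identityˡ (vk * vl) ⟩
  vk * vl                           ∎
  where
  open ≡-Reasoning
  u = 1/! n
  c = fromℕ (n C k)
  fk = fromℕ (k !)
  vk = 1/! k
  fl = fromℕ ((n ∸ k) !)
  vl = 1/! (n ∸ k)
  1/!-inverseʳ : ∀ m → fromℕ (m !) * 1/! m ≡ 1ℚ
  1/!-inverseʳ m = trans (ℚ.*-comm (fromℕ (m !)) (1/! m)) (1/ℕ-inverseˡ (m !) {{m ℕ.!≢0}})
  reassoc : ∀ a b c d e f → (a * b) * ((c * d) * (e * f)) ≡ (a * (b * (c * e))) * (d * f)
  reassoc = solve-∀ ℚ-ring
  k!l!/k!l!≡1 : (fk * vk) * (fl * vl) ≡ 1ℚ
  k!l!/k!l!≡1 = trans (cong₂ _*_ (1/!-inverseʳ k) (1/!-inverseʳ (n ∸ k))) (ℚ.*-identityˡ 1ℚ)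
  n!-factored : c * (fk * fl) ≡ fromℕ (n !)
  n!-factored = trans (cong (c *_) (sym (fromℕ-* (k !) ((n ∸ k) !))))
                (trans (sym (fromℕ-* (n C k) (k ! ℕ.* (n ∸ k) !))) (cong fromℕ (nCk*k!*[n∸k]!≡n! n k k≤n)))

-- The generating functions

forestSum : Z → ℚ → ℕ → ℚ
forestSum z x n = ∑ (λ F → pow x (ris z F)) (forests n)

forestSum≡risSum : ∀ z x n → forestSum z x n ≡ risSum z x (labels (triple n))
forestSum≡risSum z x n =
  trans (∑-filterB (λ F → pow x (ris z F)) allShrubs (map chunk3 (perms (labels (3 ℕ.* n)))))
  (trans (∑-map (risWeight z x) chunk3 (perms (labels (3 ℕ.* n))))
         (cong (risSum z x ∘ labels) (sym (triple≡3* n))))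

IZF≡incSum : ∀ z n → fromℕ (IZF z n) ≡ incSum z (labels (triple n))
IZF≡incSum z n =
  trans (fromℕ-length-filterB (increasing z) (forests n))
  (trans (∑-filterB (𝟙 ∘ increasing z) allShrubs (map chunk3 (perms (labels (3 ℕ.* n)))))
  (trans (∑-map (incWeight z) chunk3 (perms (labels (3 ℕ.* n))))
         (cong (incSum z ∘ labels) (sym (triple≡3* n)))))

module _ (z : Z) (x : ℚ) where

  private
    R I : FPS
    R = RZ z x
    I = IZseries z x

  RZ-OnTriples : OnTriples R
  RZ-OnTriples k = trans (ℚ.+-identityˡ _) (proj₁ (egf3-OnTriples (forestSum z x) k)) ,
                   trans (ℚ.+-identityˡ _) (proj₂ (egf3-OnTriples (forestSum z x) k))

  IZseries-OnTriples : OnTriples I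
  IZseries-OnTriples = egf3-OnTriples (λ n → pow (x - 1ℚ) (n ∸ 1) * fromℕ (IZF z n))

  RZ*IZseries-OnTriples : OnTriples (R *S I)
  RZ*IZseries-OnTriples = *S-OnTriples R I RZ-OnTriples IZseries-OnTriples

  RZ-triple : ∀ k → R (triple k) ≡ risSum z x (labels (triple k)) * 1/! (triple k)
  RZ-triple zero = refl
  RZ-triple (suc k) = trans (ℚ.+-identityˡ _) (trans (egf3-triple (forestSum z x) k)
                             (cong (_* 1/! (triple (suc k))) (forestSum≡risSum z x (suc k))))

  IZseries-triple : ∀ k →
    I (triple (suc k)) ≡ (pow (x - 1ℚ) k * incSum z (labels (triple (suc k)))) * 1/! (triple (suc k))
  IZseries-triple k = trans (egf3-triple _ k)
    (cong (λ c → (pow (x - 1ℚ) k * c) * 1/! (triple (suc k))) (IZF≡incSum z (suc k)))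

  private
    reverse-term : ∀ n k → k ≤ n →
      (pow (x - 1ℚ) k * (fromℕ (triple (suc n) C triple (suc k)) *
        (incSum z (labels (triple (suc k))) * risSum z x (labels (triple (n ∸ k)))))) * 1/! (triple (suc n))
      ≡ R (triple (n ∸ k)) * I (triple (suc n ∸ (n ∸ k)))
    reverse-term n k k≤n = begin
      (q * (b * (i * s))) * u    ≡⟨ reassocˡ q b i s u ⟩
      (u * b) * (q * (i * s))    ≡⟨ cong (_* (q * (i * s))) binomial ⟩
      (vj * vl) * (q * (i * s))  ≡⟨ reassocʳ vj vl q i s ⟩
      (s * vl) * ((q * i) * vj)  ≡⟨ cong₂ _*_ (RZ-triple (n ∸ k)) (IZseries-triple k) ⟨
      R (triple (n ∸ k)) * I (triple (suc k))
        ≡⟨ cong (λ m → R (triple (n ∸ k)) * I (triple m))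
                (trans (ℕ.+-∸-assoc 1 (ℕ.m∸n≤m n k)) (cong suc (ℕ.m∸[m∸n]≡n k≤n))) ⟨
      R (triple (n ∸ k)) * I (triple (suc n ∸ (n ∸ k)))
        ∎
      where
      open ≡-Reasoning
      q = pow (x - 1ℚ) k
      b = fromℕ (triple (suc n) C triple (suc k))
      i = incSum z (labels (triple (suc k)))
      s = risSum z x (labels (triple (n ∸ k)))
      u = 1/! (triple (suc n))
      vj = 1/! (triple (suc k))
      vl = 1/! (triple (n ∸ k))
      binomial : u * b ≡ vj * vl
      binomial = trans (1/!-binomial (triple (suc n)) (triple (suc k)) (triple-mono-≤ (s≤s k≤n)))
                       (cong (λ m → vj * 1/! m) (triple-∸ (suc n) (suc k)))
      reassocˡ : ∀ q b i s u → (q * (b * (i * s))) * u ≡ (u * b) * (q * (i * s))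
      reassocˡ = solve-∀ ℚ-ring
      reassocʳ : ∀ vj vl q i s → (vj * vl) * (q * (i * s)) ≡ (s * vl) * ((q * i) * vj)
      reassocʳ = solve-∀ ℚ-ring

  forestEGF-triple : ∀ n → egf3 (forestSum z x) (triple (suc n)) ≡ (R *S I) (triple (suc n))
  forestEGF-triple n = begin
    egf3 (forestSum z x) N           ≡⟨ egf3-triple (forestSum z x) n ⟩
    forestSum z x (suc n) * 1/! N
      ≡⟨ cong (_* 1/! N) (trans (forestSum≡risSum z x (suc n)) (risSum-recurrence z x n)) ⟩
    ∑< (suc n) M * 1/! N             ≡⟨ ∑<-*ʳ (suc n) (1/! N) M ⟨
    ∑< (suc n) (λ k → M k * 1/! N)   ≡⟨ ∑<-cong (suc n) (λ k k<1+n → reverse-term n k (ℕ.≤-pred k<1+n)) ⟩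
    ∑< (suc n) (λ k → g (n ∸ k))     ≡⟨ ∑<-reverse (suc n) g ⟨
    ∑< (suc n) g                     ≡⟨ ℚ.+-identityʳ (∑< (suc n) g) ⟨
    ∑< (suc n) g + 0ℚ                ≡⟨ cong (∑< (suc n) g +_) last-term ⟨
    ∑< (suc n) g + g (suc n)         ≡⟨ ∑<-sucʳ (suc n) g ⟨
    ∑< (suc (suc n)) g               ≡⟨ *S-triple R I RZ-OnTriples (suc n) ⟨
    (R *S I) N                       ∎
    where
    open ≡-Reasoning
    N = triple (suc n)
    M : ℕ → ℚ
    M k = pow (x - 1ℚ) k * (fromℕ (N C triple (suc k)) *
            (incSum z (labels (triple (suc k))) * risSum z x (labels (triple (n ∸ k)))))
    g : ℕ → ℚ
    g a = R (triple a) * I (triple (suc n ∸ a))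
    last-term : g (suc n) ≡ 0ℚ
    last-term = trans (cong (λ m → R N * I (triple m)) (ℕ.n∸n≡0 n)) (ℚ.*-zeroʳ (R N))

  forestEGF≡RZ*IZseries : ∀ m → egf3 (forestSum z x) m ≡ (R *S I) m
  forestEGF≡RZ*IZseries m with mod3 m
  ... | 3k zero = refl
  ... | 3k (suc n) = forestEGF-triple n
  ... | 3k+1 c = trans (proj₁ (egf3-OnTriples (forestSum z x) c)) (sym (proj₁ (RZ*IZseries-OnTriples c)))
  ... | 3k+2 c = trans (proj₂ (egf3-OnTriples (forestSum z x) c)) (sym (proj₂ (RZ*IZseries-OnTriples c)))

theorem2 : (z : Z) (x : ℚ) (m : ℕ) →
    (RZ z x *S (oneS -S IZseries z x)) m ≡ oneS m
theorem2 z x m = begin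
  (RZ z x *S (oneS -S IZseries z x)) m
    ≡⟨ *S--S (RZ z x) oneS (IZseries z x) m ⟩
  (RZ z x *S oneS) m - (RZ z x *S IZseries z x) m
    ≡⟨ cong₂ _-_ (*S-oneSʳ (RZ z x) m) (sym (forestEGF≡RZ*IZseries z x m)) ⟩
  (oneS m + egf3 (forestSum z x) m) - egf3 (forestSum z x) m
    ≡⟨ a+b-b≡a (oneS m) (egf3 (forestSum z x) m) ⟩
  oneS m
    ∎
  where
  open ≡-Reasoning
  a+b-b≡a : ∀ a b → (a + b) - b ≡ a
  a+b-b≡a a b = trans (ℚ.+-assoc a b (- b)) (trans (cong (a +_) (ℚ.+-inverseʳ b)) (ℚ.+-identityʳ a))
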